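{- Let $k\ge 4$ and let $n,n_1,m,m_1$ be integers with $n>n_1\ge 2$, $m>m_1\ge 1$ and $n\ge k+2$. Then the two equalities $$F_n^{(k)}-3^m=F_{n_1}^{(k)}-3^{m_1}\qquad\text{and}\qquad 2^{n-2}-3^m=2^{n_1-2}-3^{m_1}$$ cannot hold simultaneously.
   Context: For an integer $k\ge 2$, the $k$-generalized Fibonacci sequence $(F_n^{(k)})_{n\ge 2-k}$ is defined by $F_{ -(k-2)}^{(k)}=\cdots=F_0^{(k)}=0$, $F_1^{(k)}=1$, and $F_n^{(k)}=F_{n-1}^{(k)}+\cdots+F_{n-k}^{(k)}$ for $n\ge 2$. -}

module Defs where

open import Data.Nat using (ℕ; zero; suc; _+_; _∸_)
open import Data.List using (List; []; _∷_; take)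
open import Data.Nat.ListAction using (sum)

-- Window of the last values: fibWin k n = [F_n, F_{n-1}, ..., F_0] (with the
-- list having length n+1); values F_j for j ≤ 0 are 0.
fibWin : ℕ → ℕ → List ℕ
fibWin k zero = 0 ∷ []
fibWin k (suc zero) = 1 ∷ 0 ∷ []
fibWin k (suc (suc n)) = step (fibWin k (suc n))
  where
  step : List ℕ → List ℕ
  step w = sum (take k w) ∷ w

F : ℕ → ℕ → ℕ
F k n with fibWin k n
... | x ∷ _ = x
... | [] = 0

{-# OPTIONS --safe #-}
-- Subtracting the two equalities eliminates the powers of 3 and gives
-- F_n − F_{n₁} = 2^{n−2} − 2^{n₁−2}, i.e. the gap 2^{n−2} − F_n takes the same
-- value at n and n₁.  From F_{n+1} = 2F_n − F_{n−k} the gap satisfies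
-- gap(n+1) = 2·gap(n) + F_{n−k}, so it is nondecreasing, and strictly increasing
-- as soon as F_{n−k} ≥ 1, i.e. for n ≥ k+1; this rules out gap(n) = gap(n₁)
-- when n > n₁ and n ≥ k+2.
module Submission where

open import Defs
open import Data.Nat using (ℕ; _≤_; _<_; _∸_; _+_)
open import Data.Integer using (+_; _-_)
open import Data.Product using (_×_; _,_)
open import Relation.Binary.PropositionalEquality using (_≡_)
open import Relation.Nullary using (¬_)
open import Data.Nat using (zero; suc; _*_; _^_; z≤n; s≤s; _≤′_; ≤′-refl; ≤′-step)
open import Data.Nat.Properties
  using (≤-refl; ≤-trans; ≤-<-trans; <-irrefl; ≤⇒≤′; m≤m+n; m≤n+m; +-mono-≤;
         +-comm; +-assoc; +-identityʳ; +-cancelˡ-≡; +-cancelˡ-≤; *-distribˡ-+)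
import Data.Integer as ℤ
open import Data.Integer.Properties using (pos-+; +-injective)
open import Data.List using (List; []; _∷_; take)
open import Data.Nat.ListAction using (sum)
open import Relation.Binary.PropositionalEquality using (refl; sym; trans; cong; subst; subst₂; module ≡-Reasoning)
import Data.Integer.Tactic.RingSolver as ℤ-Solver
import Data.Nat.Tactic.RingSolver as ℕ-Solver

-- Out-of-range entries read as 0, matching F_j = 0 for j ≤ 0.
entry : ℕ → List ℕ → ℕ
entry _ [] = 0
entry zero (x ∷ _) = x
entry (suc i) (_ ∷ w) = entry i w

sum-take-suc : ∀ i w → sum (take (suc i) w) ≡ sum (take i w) + entry i w
sum-take-suc zero [] = refl
sum-take-suc (suc i) [] = refl
sum-take-suc zero (x ∷ w) = +-comm x 0
sum-take-suc (suc i) (x ∷ w) = trans (cong (_+_ x) (sum-take-suc i w)) (sym (+-assoc x _ _))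

head≤sum-take-suc : ∀ i w → entry 0 w ≤ sum (take (suc i) w)
head≤sum-take-suc i [] = z≤n
head≤sum-take-suc i (x ∷ w) = m≤m+n x _

entry-fibWin-positive : ∀ k' b i → i ≤ b → 1 ≤ entry i (fibWin (suc k') (suc b))
entry-fibWin-positive k' zero zero _ = s≤s z≤n
entry-fibWin-positive k' (suc b) zero _ =
  ≤-trans (entry-fibWin-positive k' b zero z≤n) (head≤sum-take-suc k' (fibWin (suc k') (suc b)))
entry-fibWin-positive k' (suc b) (suc i) (s≤s i≤b) = entry-fibWin-positive k' b i i≤b

-- F_{n+1} + F_{n−k} = 2F_n for n = a+2: position k' of fibWin (suc k') (1 + a) holds F_{1+a−k'}.
F-suc+entry≡2*F : ∀ k' a → F (suc k') (3 + a) + entry k' (fibWin (suc k') (1 + a)) ≡ 2 * F (suc k') (2 + a)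
F-suc+entry≡2*F k' a = begin
  X + sum (take k' w) + entry k' w   ≡⟨ +-assoc X _ _ ⟩
  X + (sum (take k' w) + entry k' w) ≡⟨ cong (_+_ X) (sym (sum-take-suc k' w)) ⟩
  X + X                              ≡⟨ cong (_+_ X) (sym (+-identityʳ X)) ⟩
  2 * X                              ∎
  where
  open ≡-Reasoning
  w = fibWin (suc k') (1 + a)
  X = sum (take (suc k') w)

gap : ℕ → ℕ → ℕ
gap k' zero = 0
gap k' (suc a) = entry k' (fibWin (suc k') (1 + a)) + 2 * gap k' a

2^a≡F+gap : ∀ k' a → 2 ^ a ≡ F (suc k') (2 + a) + gap k' a
2^a≡F+gap zero zero = refl
2^a≡F+gap (suc zero) zero = refl
2^a≡F+gap (suc (suc _)) zero = refl
2^a≡F+gap k' (suc a) = begin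
  2 * 2 ^ a                                ≡⟨ cong (2 *_) (2^a≡F+gap k' a) ⟩
  2 * (Fₐ + gap k' a)                       ≡⟨ *-distribˡ-+ 2 Fₐ (gap k' a) ⟩
  2 * Fₐ + 2 * gap k' a                     ≡⟨ cong (_+ 2 * gap k' a) (sym (F-suc+entry≡2*F k' a)) ⟩
  F (suc k') (3 + a) + e + 2 * gap k' a     ≡⟨ +-assoc (F (suc k') (3 + a)) e _ ⟩
  F (suc k') (3 + a) + (e + 2 * gap k' a)   ∎
  where
  open ≡-Reasoning
  Fₐ = F (suc k') (2 + a)
  e = entry k' (fibWin (suc k') (1 + a))

gap-≤-suc : ∀ k' a → gap k' a ≤ gap k' (suc a)
gap-≤-suc k' a = ≤-trans (m≤m+n (gap k' a) (gap k' a + 0)) (m≤n+m (2 * gap k' a) (entry k' (fibWin (suc k') (1 + a))))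

gap-<-suc : ∀ k' c → k' ≤ c → gap k' c < gap k' (suc c)
gap-<-suc k' c k'≤c = +-mono-≤ (entry-fibWin-positive k' c k' k'≤c) (m≤m+n (gap k' c) (gap k' c + 0))

monotone-from-step : (f : ℕ → ℕ) → (∀ a → f a ≤ f (suc a)) → ∀ {a b} → a ≤′ b → f a ≤ f b
monotone-from-step f step ≤′-refl = ≤-refl
monotone-from-step f step (≤′-step a≤′b) = ≤-trans (monotone-from-step f step a≤′b) (step _)

+a-+b≡+c-+d⇒a+d≡c+b : ∀ a b c d → + a - + b ≡ + c - + d → a + d ≡ c + b
+a-+b≡+c-+d⇒a+d≡c+b a b c d eq = +-injective (begin
  + (a + d)                         ≡⟨ pos-+ a d ⟩
  + a ℤ.+ + d                       ≡⟨ add-sub (+ a) (+ b) (+ d) ⟩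
  (+ a - + b) ℤ.+ (+ b ℤ.+ + d)     ≡⟨ cong (ℤ._+ (+ b ℤ.+ + d)) eq ⟩
  (+ c - + d) ℤ.+ (+ b ℤ.+ + d)     ≡⟨ sub-add (+ c) (+ b) (+ d) ⟩
  + c ℤ.+ + b                       ≡⟨ sym (pos-+ c b) ⟩
  + (c + b)                         ∎)
  where
  open ≡-Reasoning
  add-sub : ∀ x y z → x ℤ.+ z ≡ (x - y) ℤ.+ (y ℤ.+ z)
  add-sub = ℤ-Solver.solve-∀
  sub-add : ∀ x y z → (x - z) ℤ.+ (y ℤ.+ z) ≡ x ℤ.+ y
  sub-add = ℤ-Solver.solve-∀

same-offsets⇒same-excess : ∀ p q x y d e → p + y ≡ q + x → (p + d) + y ≡ (q + e) + x → d ≡ e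
same-offsets⇒same-excess p q x y d e offsets totals = +-cancelˡ-≡ (p + y) d e (begin
  (p + y) + d   ≡⟨ swap p y d ⟩
  (p + d) + y   ≡⟨ totals ⟩
  (q + e) + x   ≡⟨ swap q e x ⟩
  (q + x) + e   ≡⟨ cong (_+ e) (sym offsets) ⟩
  (p + y) + e   ∎)
  where
  open ≡-Reasoning
  swap : ∀ r s t → (r + s) + t ≡ (r + t) + s
  swap = ℕ-Solver.solve-∀

lemma3p1 : ∀ (k n n₁ m m₁ : ℕ) → 4 ≤ k → n₁ < n → 2 ≤ n₁ → m₁ < m → 1 ≤ m₁ → k + 2 ≤ n →
    ¬ ((+ F k n - + (3 Data.Nat.^ m) ≡ + F k n₁ - + (3 Data.Nat.^ m₁))
    × (+ (2 Data.Nat.^ (n ∸ 2)) - + (3 Data.Nat.^ m) ≡ + (2 Data.Nat.^ (n₁ ∸ 2)) - + (3 Data.Nat.^ m₁)))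
lemma3p1 (suc k') (suc (suc (suc c))) (suc (suc a)) m m₁ _ (s≤s (s≤s (s≤s a≤c))) (s≤s (s≤s _)) _ _ (s≤s k'+2≤2+c) (fib-eq , pow-eq) =
  <-irrefl (sym equal-gaps) (≤-<-trans gap-a≤gap-c (gap-<-suc k' c k'≤c))
  where
  k'≤c : k' ≤ c
  k'≤c = +-cancelˡ-≤ 2 k' c (subst (_≤ 2 + c) (+-comm k' 2) k'+2≤2+c)
  gap-a≤gap-c : gap k' a ≤ gap k' c
  gap-a≤gap-c = monotone-from-step (gap k') (gap-≤-suc k') (≤⇒≤′ a≤c)
  equal-gaps : gap k' (suc c) ≡ gap k' a
  equal-gaps = same-offsets⇒same-excess Fₙ Fₙ₁ (3 ^ m) (3 ^ m₁) (gap k' (suc c)) (gap k' a)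
    (+a-+b≡+c-+d⇒a+d≡c+b Fₙ (3 ^ m) Fₙ₁ (3 ^ m₁) fib-eq)
    (subst₂ (λ s t → s + 3 ^ m₁ ≡ t + 3 ^ m) (2^a≡F+gap k' (suc c)) (2^a≡F+gap k' a)
      (+a-+b≡+c-+d⇒a+d≡c+b (2 ^ suc c) (3 ^ m) (2 ^ a) (3 ^ m₁) pow-eq))
    where
    Fₙ = F (suc k') (3 + c)
    Fₙ₁ = F (suc k') (2 + a)
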